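{- Let $d^\star_k = \frac{\ln k}{(k-1)(-\ln(1-1/k))} + 1$. If $d > d^\star_k$, then $F_{n,d,k}$ is unsatisfiable with high probability, i.e. $\Pr[F_{n,d,k} \text{ is satisfiable}] \to 0$ as $n \to \infty$.
   Context: Fix positive integers $d$ and $k\ge 2$. For $n$ such that $k$ divides $dn$, set $m = dn/k$. The random formula $F_{n,d,k}$ is generated by the configuration model: there are $n$ variables and $m$ clauses; make $d$ copies of each variable and $k$ copies of each clause, and choose a uniformly random perfect matching between the $dn$ variable-copies and the $km$ clause-copies. A satisfying assignment is a subset $T$ of the variables such that every clause is matched to exactly one copy of a variable in $T$. $F_{n,d,k}$ is satisfiable if such a $T$ exists. The limit is over $n$ with $k \mid dn$. -}

module Defs where

open import Data.Nat using (ℕ; zero; suc; _+_; _*_; NonZero; _≡ᵇ_)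
open import Data.Nat.DivMod using (_/_)
open import Data.Bool using (Bool; true; false; _∧_; _∨_; not)
open import Data.Fin using (Fin; quotient)
open import Data.Fin.Properties using () renaming (_≟_ to _≟ᶠ_)
open import Data.List using (List; []; _∷_; concatMap; map; allFin)
open import Data.Bool.ListAction using (all; any)
open import Data.Vec using (Vec; []; _∷_; lookup)
open import Relation.Nullary using (does)

allVecs : ∀ {A : Set} → List A → (len : ℕ) → List (Vec A len)
allVecs xs zero    = [] ∷ []
allVecs xs (suc l) = concatMap (λ x → map (x ∷_) (allVecs xs l)) xs

count : ∀ {A : Set} → (A → Bool) → List A → ℕ
count p []       = 0
count p (x ∷ xs) with p x
... | true  = suc (count p xs)
... | false = count p xs

clauses : (n d k : ℕ) .{{_ : NonZero k}} → ℕ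
clauses n d k = (n * d) / k

-- A configuration: variable copies are Fin (n * d), copy i belongs to
-- variable (quotient d i) = ⌊i/d⌋; clause copies are Fin (m * k), copy j
-- belongs to clause (quotient k j) = ⌊j/k⌋.  The vector σ sends variable
-- copy i to the clause copy σ[i] it is matched with.
Config : (n d k : ℕ) .{{_ : NonZero k}} → Set
Config n d k = Vec (Fin (clauses n d k * k)) (n * d)

-- σ is injective; since n*d = m*k (when k ∣ dn) this means σ is a perfect matching.
isMatching : ∀ {a b} → Vec (Fin b) a → Bool
isMatching {a} σ =
  all (λ i → all (λ j → does (i ≟ᶠ j) ∨ not (does (lookup σ i ≟ᶠ lookup σ j)))
                 (allFin a))
      (allFin a)

-- T (characteristic vector of a subset of the variables) is a satisfying
-- assignment of the formula σ: every clause c is matched to exactly one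
-- copy of a variable in T.
satisfies : (n d k : ℕ) .{{_ : NonZero k}} → Config n d k → Vec Bool n → Bool
satisfies n d k σ T =
  all (λ c → count (λ i → does (quotient k (lookup σ i) ≟ᶠ c) ∧ lookup T (quotient d i))
                   (allFin (n * d)) ≡ᵇ 1)
      (allFin (clauses n d k))

satisfiable : (n d k : ℕ) .{{_ : NonZero k}} → Config n d k → Bool
satisfiable n d k σ = any (satisfies n d k σ) (allVecs (true ∷ false ∷ []) n)

numMatchings : (n d k : ℕ) .{{_ : NonZero k}} → ℕ
numMatchings n d k = count isMatching (allVecs (allFin (clauses n d k * k)) (n * d))

numSatMatchings : (n d k : ℕ) .{{_ : NonZero k}} → ℕ
numSatMatchings n d k =
  count (λ σ → isMatching σ ∧ satisfiable n d k σ)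
        (allVecs (allFin (clauses n d k * k)) (n * d))

-- Pr[F_{n,d,k} satisfiable] = numSatMatchings / numMatchings.
-- Threshold condition d > d*_k = ln k / ((k-1)(-ln(1-1/k))) + 1, rewritten
-- exactly in integer arithmetic:
--   k ^ ((d-1)(k-1)) > k * (k-1) ^ ((d-1)(k-1)).
AboveThreshold : (d k : ℕ) → Set
AboveThreshold d k =
  k * (k ∸ 1) ^ ((d ∸ 1) * (k ∸ 1)) < k ^ ((d ∸ 1) * (k ∸ 1))
  where open import Data.Nat using (_∸_; _^_; _<_)

module Submission where

-- First moment method.  In a solution (σ, T) every clause meets T exactly once,
-- so |T|·d = m: there is no solution unless k ∣ n, and otherwise |T| = t = n/k.
-- For a fixed T read σ from the clause side: its inverse must put exactly one
-- copy of a variable of T into each block of k clause copies, which leaves at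
-- most k^m · m! · (m(k-1))! matchings.  Summing over T, the expected number of
-- solutions is at most C(tk,t) k^m / C(mk,m).  Both binomials are compared
-- with the expansion of k^N = (1 + (k-1))^N: C(tk,t) (k-1)^(t(k-1)) is one of
-- its terms, and C(mk,m) (k-1)^(m(k-1)) is its largest one, so it is at least
-- k^(mk) / (mk+1).  With m = td and e = (d-1)(k-1) the expectation is at most
-- (mk+1) (k (k-1)^e / k^e)^t, which tends to 0 exactly when k (k-1)^e < k^e,
-- the integer form of d > d*_k.

open import Defs
open import Data.Nat using (ℕ; suc; _*_; _≤_; _<_; NonZero)
open import Data.Nat.Divisibility using (_∣_)
open import Data.Product using (∃-syntax)

open import Data.Nat using (+-0-rawMonoid; >-nonZero; zero; pred; _+_; _∸_; _^_; _!; z≤n; s≤s)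
open import Data.Nat.Properties hiding (_≟_; 0≢1+n; suc-injective)
open import Data.Nat.Combinatorics
  using (_C_; nCk+nC[k+1]≡[n+1]C[k+1]; k>n⇒nCk≡0; nCk≡nC[n∸k]; nCn≡1; nC1≡n; nCk≡n!/k![n-k]!; k![n∸k]!∣n!)
open import Data.Nat.DivMod using (_/_; m/n*n≡m; m*n/n≡m)
open import Data.Nat.Divisibility using (divides; _∣?_)
open import Data.Nat.ListAction using (sum)
open import Data.Nat.ListAction.Properties using (sum-++)
open import Data.Nat.Tactic.RingSolver using (solve-∀)
open import Data.Bool using (Bool; true; false; T; _∧_; _∨_; not; if_then_else_)
open import Data.Bool.Properties using (∧-identityʳ; ∧-zeroʳ; T-∧; T-≡)
open import Data.Bool.ListAction using (any; all)
open import Data.Empty using (⊥-elim)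
open import Data.Product using (_×_; _,_; proj₁; proj₂; map₂)
open import Data.Sum using (inj₁; inj₂)
open import Data.List using (List; []; _∷_; _++_; map; length; filter; concatMap; cartesianProductWith; allFin)
import Data.List as List
open import Data.List.Properties using (length-++-sucʳ; length-++; length-map; length-tabulate; map-++; map-∘; ++-identityʳ)
open import Data.List.Membership.Propositional using (_∈_)
open import Data.List.Membership.Propositional.Properties
  using (∈-∃++; ∈-++⁻; ∈-++⁺ˡ; ∈-++⁺ʳ; ∈-filter⁺; ∈-filter⁻; ∈-cartesianProductWith⁺; ∈-cartesianProductWith⁻;
         ∈-allFin; ∈-map⁺; ∈-map⁻)
open import Data.List.Relation.Unary.All as All using (All)
open import Data.List.Relation.Unary.All.Properties using (all⁺; all⁻)
open import Data.List.Relation.Unary.Any as Any using (here; there)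
open import Data.List.Relation.Unary.Any.Properties using (any⁺; any⁻)
open import Data.List.Relation.Unary.AllPairs using ([]; _∷_)
open import Data.List.Relation.Unary.Unique.Propositional using (Unique)
import Data.List.Relation.Unary.Unique.Propositional.Properties as Unique
open import Data.Fin using (Fin; zero; suc; _↑ˡ_; _↑ʳ_; punchOut; quotient; toℕ; fromℕ<)
open import Data.Fin.Properties
  using (_≟_; suc-injective; 0≢1+n; any?; punchOut-injective; injective⇒≤; splitAt-↑ˡ; splitAt-↑ʳ; toℕ-fromℕ<)
open import Data.Vec using (Vec; []; _∷_; lookup; replicate; tabulate; concat; group) renaming (_++_ to _++ᵛ_)
import Data.Vec as Vec
open import Data.Vec.Properties
  using (lookup-map; ∷-injective; lookup∘tabulate; tabulate∘lookup; tabulate-cong; lookup-++ˡ; lookup-++ʳ)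
open import Function using (_∘_; id)
open import Function.Bundles using (Equivalence)
open import Function.Definitions using (Injective)
open import Relation.Binary.Definitions using (tri<; tri≈; tri>)
open import Relation.Binary.PropositionalEquality
open import Relation.Nullary using (¬_; yes; no; contradiction)
open import Relation.Nullary.Decidable using (T?; does)
open import Algebra.Definitions.RawMonoid +-0-rawMonoid as Additive using () renaming (sum to ∑)
open import Algebra.Properties.Monoid.Sum +-0-monoid using (sum-cong-≗)
import Algebra.Properties.Semiring.Exp +-*-semiring as Exp
open import Algebra.Properties.CommutativeSemiring.Binomial +-*-commutativeSemiring as Binomial using (binomialExpansion)
open import Algebra.Properties.CommutativeSemigroup *-commutativeSemigroup
  using (xy∙z≈xz∙y; x∙yz≈y∙xz; xy∙z≈y∙xz; interchange)
import Algebra.Properties.CommutativeSemigroup +-commutativeSemigroup as +-CS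

private variable
  A B : Set
  l : ℕ

T-∧⁻ : {a b : Bool} → T (a ∧ b) → T a × T b
T-∧⁻ = Equivalence.to T-∧

T-∧⁺ : {a b : Bool} → T a × T b → T (a ∧ b)
T-∧⁺ = Equivalence.from T-∧

fromBool : Bool → ℕ
fromBool true  = 1
fromBool false = 0

count-∷ : (p : A → Bool) (x : A) (xs : List A) → count p (x ∷ xs) ≡ fromBool (p x) + count p xs
count-∷ p x xs with p x
... | true  = refl
... | false = refl

count-++ : (p : A → Bool) (xs ys : List A) → count p (xs ++ ys) ≡ count p xs + count p ys
count-++ p []       ys = refl
count-++ p (x ∷ xs) ys = begin
  count p (x ∷ xs ++ ys)                       ≡⟨ count-∷ p x (xs ++ ys) ⟩
  fromBool (p x) + count p (xs ++ ys)          ≡⟨ cong (fromBool (p x) +_) (count-++ p xs ys) ⟩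
  fromBool (p x) + (count p xs + count p ys)   ≡⟨ +-assoc (fromBool (p x)) _ _ ⟨
  fromBool (p x) + count p xs + count p ys     ≡⟨ cong (_+ count p ys) (count-∷ p x xs) ⟨
  count p (x ∷ xs) + count p ys                ∎
  where open ≡-Reasoning

count-map : (p : B → Bool) (f : A → B) (xs : List A) → count p (map f xs) ≡ count (p ∘ f) xs
count-map p f []       = refl
count-map p f (x ∷ xs) with p (f x)
... | true  = cong suc (count-map p f xs)
... | false = count-map p f xs

count-cong : {p q : A → Bool} → (∀ x → p x ≡ q x) → (xs : List A) → count p xs ≡ count q xs
count-cong p≗q []       = refl
count-cong {p = p} {q} p≗q (x ∷ xs) = begin
  count p (x ∷ xs)              ≡⟨ count-∷ p x xs ⟩
  fromBool (p x) + count p xs   ≡⟨ cong₂ _+_ (cong fromBool (p≗q x)) (count-cong p≗q xs) ⟩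
  fromBool (q x) + count q xs   ≡⟨ count-∷ q x xs ⟨
  count q (x ∷ xs)              ∎
  where open ≡-Reasoning

count-mono : {p q : A → Bool} → (∀ {x} → T (p x) → T (q x)) → (xs : List A) → count p xs ≤ count q xs
count-mono p⇒q [] = z≤n
count-mono {p = p} {q} p⇒q (x ∷ xs) with p x in px | q x in qx
... | true  | true  = s≤s (count-mono p⇒q xs)
... | false | true  = m≤n⇒m≤1+n (count-mono p⇒q xs)
... | false | false = count-mono p⇒q xs
... | true  | false = ⊥-elim (subst T qx (p⇒q (subst T (sym px) _)))

count-false : (xs : List A) → count (λ _ → false) xs ≡ 0
count-false []       = refl
count-false (x ∷ xs) = count-false xs

count-∨ : (p q : A → Bool) (xs : List A) → count (λ x → p x ∨ q x) xs ≤ count p xs + count q xs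
count-∨ p q [] = z≤n
count-∨ p q (x ∷ xs) with p x | q x
... | true  | true  = s≤s (≤-trans (count-∨ p q xs) (+-monoʳ-≤ (count p xs) (n≤1+n _)))
... | true  | false = s≤s (count-∨ p q xs)
... | false | true  = ≤-trans (s≤s (count-∨ p q xs)) (≤-reflexive (sym (+-suc _ _)))
... | false | false = count-∨ p q xs

count+count-not : (p : A → Bool) (xs : List A) → count p xs + count (not ∘ p) xs ≡ length xs
count+count-not p []       = refl
count+count-not p (x ∷ xs) with p x
... | true  = cong suc (count+count-not p xs)
... | false = trans (+-suc (count p xs) _) (cong suc (count+count-not p xs))

count≡length-filter : (p : A → Bool) (xs : List A) → count p xs ≡ length (filter (T? ∘ p) xs)
count≡length-filter p []       = refl
count≡length-filter p (x ∷ xs) with p x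
... | true  = cong suc (count≡length-filter p xs)
... | false = count≡length-filter p xs

∧-any : (a : Bool) (P : B → Bool) (ys : List B) → T (a ∧ any P ys) → T (any (λ y → a ∧ P y) ys)
∧-any a P ys a∧any with T-∧⁻ {a} a∧any
... | Ta , anyP = any⁺ _ (Any.map (λ Py → T-∧⁺ (Ta , Py)) (any⁻ P ys anyP))

count-any≤sum : (P : A → B → Bool) (xs : List A) (ys : List B) →
  count (λ x → any (P x) ys) xs ≤ sum (map (λ y → count (λ x → P x y) xs) ys)
count-any≤sum P xs []       = ≤-reflexive (count-false xs)
count-any≤sum P xs (y ∷ ys) = ≤-trans (count-∨ (λ x → P x y) (λ x → any (P x) ys) xs)
  (+-monoʳ-≤ (count (λ x → P x y) xs) (count-any≤sum P xs ys))

sum-map-mono : {f g : A → ℕ} → (∀ x → f x ≤ g x) → (xs : List A) → sum (map f xs) ≤ sum (map g xs)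
sum-map-mono f≤g []       = z≤n
sum-map-mono f≤g (x ∷ xs) = +-mono-≤ (f≤g x) (sum-map-mono f≤g xs)

sum-map-const : {f : A → ℕ} {c : ℕ} {xs : List A} → All (λ x → f x ≡ c) xs → sum (map f xs) ≡ length xs * c
sum-map-const All.[]           = refl
sum-map-const (fx≡c All.∷ fxs) = cong₂ _+_ fx≡c (sum-map-const fxs)

sum-count-∧ : (P : A → Bool) (F : A → B → Bool) {c : ℕ} (xs : List A) (ys : List B) →
  (∀ x → T (P x) → count (F x) ys ≡ c) →
  sum (map (λ x → count (λ y → P x ∧ F x y) ys) xs) ≡ count P xs * c
sum-count-∧ P F []       ys F≡c = refl
sum-count-∧ P F (x ∷ xs) ys F≡c with P x in Px
... | true  = cong₂ _+_ (F≡c x (subst T (sym Px) _)) (sum-count-∧ P F xs ys F≡c)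
... | false = trans (cong (_+ sum (map (λ x → count (λ y → P x ∧ F x y) ys) xs)) (count-false ys))
                    (sum-count-∧ P F xs ys F≡c)

length-≤-injection : (f : A → B) {xs : List A} {ys : List B} → Unique xs →
  (∀ {x y} → x ∈ xs → y ∈ xs → f x ≡ f y → x ≡ y) → (∀ {x} → x ∈ xs → f x ∈ ys) →
  length xs ≤ length ys
length-≤-injection f {[]}     _              _   _    = z≤n
length-≤-injection f {x ∷ xs} (x∉xs ∷ uniq) inj into with ∈-∃++ (into (here refl))
... | ys₁ , ys₂ , refl = begin
  suc (length xs)                ≤⟨ s≤s (length-≤-injection f uniq (λ x∈ y∈ → inj (there x∈) (there y∈)) into′) ⟩
  suc (length (ys₁ ++ ys₂))      ≡⟨ length-++-sucʳ ys₁ (f x) ys₂ ⟨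
  length (ys₁ ++ f x ∷ ys₂)      ∎
  where
  open ≤-Reasoning
  into′ : ∀ {y} → y ∈ xs → f y ∈ ys₁ ++ ys₂
  into′ y∈xs with ∈-++⁻ ys₁ (into (there y∈xs))
  ... | inj₁ fy∈ys₁         = ∈-++⁺ˡ fy∈ys₁
  ... | inj₂ (here fy≡fx)   = ⊥-elim (All.lookup x∉xs y∈xs (inj (here refl) (there y∈xs) (sym fy≡fx)))
  ... | inj₂ (there fy∈ys₂) = ∈-++⁺ʳ ys₁ fy∈ys₂

count-≤-injection : (f : A → B) {p : A → Bool} {q : B → Bool} {xs : List A} {ys : List B} →
  Unique xs → (∀ y → y ∈ ys) →
  (∀ {x y} → T (p x) → T (p y) → f x ≡ f y → x ≡ y) → (∀ {x} → T (p x) → T (q (f x))) →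
  count p xs ≤ count q ys
count-≤-injection f {p} {q} {xs} {ys} uniq complete inj pres =
  subst₂ _≤_ (sym (count≡length-filter p xs)) (sym (count≡length-filter q ys))
    (length-≤-injection f (Unique.filter⁺ (T? ∘ p) uniq)
      (λ x∈ y∈ → inj (selected x∈) (selected y∈))
      (λ x∈ → ∈-filter⁺ (T? ∘ q) (complete _) (pres (selected x∈))))
  where
  selected : ∀ {x} → x ∈ filter (T? ∘ p) xs → T (p x)
  selected = proj₂ ∘ ∈-filter⁻ (T? ∘ p) {xs = xs}

length-cartesianProductWith : {C : Set} (f : A → B → C) (xs : List A) (ys : List B) →
  length (cartesianProductWith f xs ys) ≡ length xs * length ys
length-cartesianProductWith f []       ys = refl
length-cartesianProductWith f (x ∷ xs) ys = begin
  length (map (f x) ys ++ cartesianProductWith f xs ys)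
    ≡⟨ length-++ (map (f x) ys) ⟩
  length (map (f x) ys) + length (cartesianProductWith f xs ys)
    ≡⟨ cong₂ _+_ (length-map (f x) ys) (length-cartesianProductWith f xs ys) ⟩
  length ys + length xs * length ys
    ∎
  where open ≡-Reasoning

count-cartesianProductWith : {C : Set} (p : C → Bool) (f : A → B → C) (xs : List A) (ys : List B) →
  count p (cartesianProductWith f xs ys) ≡ sum (map (λ x → count (p ∘ f x) ys) xs)
count-cartesianProductWith p f []       ys = refl
count-cartesianProductWith p f (x ∷ xs) ys = begin
  count p (map (f x) ys ++ cartesianProductWith f xs ys)
    ≡⟨ count-++ p (map (f x) ys) _ ⟩
  count p (map (f x) ys) + count p (cartesianProductWith f xs ys)
    ≡⟨ cong₂ _+_ (count-map p (f x) ys) (count-cartesianProductWith p f xs ys) ⟩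
  count (p ∘ f x) ys + sum (map (λ x → count (p ∘ f x) ys) xs)
    ∎
  where open ≡-Reasoning

allVecs-suc : (xs : List A) (l : ℕ) → allVecs xs (suc l) ≡ cartesianProductWith _∷_ xs (allVecs xs l)
allVecs-suc {A = A} xs l = go xs
  where
  go : (ys : List A) → concatMap (λ y → map (y ∷_) (allVecs xs l)) ys ≡ cartesianProductWith _∷_ ys (allVecs xs l)
  go []       = refl
  go (y ∷ ys) = cong (map (y ∷_) (allVecs xs l) ++_) (go ys)

allVecs-unique : {xs : List A} → Unique xs → (l : ℕ) → Unique (allVecs xs l)
allVecs-unique uniq zero    = All.[] ∷ []
allVecs-unique {xs = xs} uniq (suc l) = subst Unique (sym (allVecs-suc xs l))
  (Unique.cartesianProductWith⁺ _∷_ ∷-injective uniq (allVecs-unique uniq l))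

∈-allVecs⁺ : {xs : List A} {l : ℕ} (v : Vec A l) → (∀ i → lookup v i ∈ xs) → v ∈ allVecs xs l
∈-allVecs⁺ []      _   = here refl
∈-allVecs⁺ {xs = xs} {suc l} (x ∷ v) v⊆xs = subst (x ∷ v ∈_) (sym (allVecs-suc xs l))
  (∈-cartesianProductWith⁺ _∷_ (v⊆xs zero) (∈-allVecs⁺ v (v⊆xs ∘ suc)))

∈-allVecs⁻ : {xs : List A} {l : ℕ} {v : Vec A l} → v ∈ allVecs xs l → ∀ i → lookup v i ∈ xs
∈-allVecs⁻ {xs = xs} {suc l} v∈ i
  with ∈-cartesianProductWith⁻ _∷_ xs (allVecs xs l) (subst (_ ∈_) (allVecs-suc xs l) v∈)
∈-allVecs⁻ _ zero    | x , w , x∈xs , w∈ , refl = x∈xs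
∈-allVecs⁻ _ (suc i) | x , w , x∈xs , w∈ , refl = ∈-allVecs⁻ w∈ i

length-allVecs : (xs : List A) (l : ℕ) → length (allVecs xs l) ≡ length xs ^ l
length-allVecs xs zero    = refl
length-allVecs xs (suc l) = begin
  length (allVecs xs (suc l))                                 ≡⟨ cong length (allVecs-suc xs l) ⟩
  length (cartesianProductWith _∷_ xs (allVecs xs l))         ≡⟨ length-cartesianProductWith _∷_ xs (allVecs xs l) ⟩
  length xs * length (allVecs xs l)                           ≡⟨ cong (length xs *_) (length-allVecs xs l) ⟩
  length xs * length xs ^ l                                   ∎
  where open ≡-Reasoning

count-allVecs-suc : (p : Vec A (suc l) → Bool) (xs : List A) →
  count p (allVecs xs (suc l)) ≡ sum (map (λ x → count (p ∘ (x ∷_)) (allVecs xs l)) xs)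
count-allVecs-suc {l = l} p xs =
  trans (cong (count p) (allVecs-suc xs l)) (count-cartesianProductWith p _∷_ xs (allVecs xs l))

count-tabulate : {n : ℕ} (p : A → Bool) (f : Fin n → A) → count p (List.tabulate f) ≡ count (p ∘ f) (allFin n)
count-tabulate {n = zero}  p f = refl
count-tabulate {n = suc n} p f = begin
  count p (f zero ∷ List.tabulate (f ∘ suc))          ≡⟨ count-∷ p (f zero) _ ⟩
  head + count p (List.tabulate (f ∘ suc))            ≡⟨ cong (head +_) (count-tabulate p (f ∘ suc)) ⟩
  head + count (p ∘ f ∘ suc) (allFin n)               ≡⟨ cong (head +_) (count-tabulate (p ∘ f) suc) ⟨
  head + count (p ∘ f) (List.tabulate suc)            ≡⟨ count-∷ (p ∘ f) zero _ ⟨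
  count (p ∘ f) (allFin (suc n))                      ∎
  where
  open ≡-Reasoning
  head : ℕ
  head = fromBool (p (f zero))

size : {n : ℕ} → (Fin n → Bool) → ℕ
size {n} p = count p (allFin n)

size-suc : {n : ℕ} (p : Fin (suc n) → Bool) → size p ≡ fromBool (p zero) + size (p ∘ suc)
size-suc p = trans (count-∷ p zero _) (cong (fromBool (p zero) +_) (count-tabulate p suc))

size-↑ : (a b : ℕ) (p : Fin (a + b) → Bool) → size p ≡ size (p ∘ (_↑ˡ b)) + size (p ∘ (a ↑ʳ_))
size-↑ zero    b p = refl
size-↑ (suc a) b p = begin
  size p                                                 ≡⟨ size-suc p ⟩
  fromBool (p zero) + size (p ∘ suc)                     ≡⟨ cong (fromBool (p zero) +_) (size-↑ a b (p ∘ suc)) ⟩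
  fromBool (p zero) + (size (p ∘ suc ∘ (_↑ˡ b)) + right) ≡⟨ +-assoc (fromBool (p zero)) _ right ⟨
  fromBool (p zero) + size (p ∘ suc ∘ (_↑ˡ b)) + right   ≡⟨ cong (_+ right) (size-suc (p ∘ (_↑ˡ b))) ⟨
  size (p ∘ (_↑ˡ b)) + right                             ∎
  where
  open ≡-Reasoning
  right : ℕ
  right = size (p ∘ (suc a ↑ʳ_))

size-true : (n : ℕ) → size {n} (λ _ → true) ≡ n
size-true zero    = refl
size-true (suc n) = trans (size-suc {n} (λ _ → true)) (cong suc (size-true n))

size-not : {n : ℕ} (p : Fin n → Bool) → size (not ∘ p) ≡ n ∸ size p
size-not {n} p = begin
  size (not ∘ p)                        ≡⟨ m+n∸m≡n (size p) _ ⟨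
  size p + size (not ∘ p) ∸ size p      ≡⟨ cong (_∸ size p) (count+count-not p (allFin n)) ⟩
  length (allFin n) ∸ size p            ≡⟨ cong (_∸ size p) (length-tabulate id) ⟩
  n ∸ size p                            ∎
  where open ≡-Reasoning

_∖_ : {n : ℕ} → (Fin n → Bool) → Fin n → Fin n → Bool
(p ∖ x) y = p y ∧ not (does (y ≟ x))

size-∖ : {n : ℕ} (p : Fin n → Bool) (x : Fin n) → size p ≡ fromBool (p x) + size (p ∖ x)
size-∖ {suc n} p zero = begin
  size p
    ≡⟨ size-suc p ⟩
  fromBool (p zero) + size (p ∘ suc)
    ≡⟨ cong₂ (λ b s → fromBool (p zero) + (fromBool b + s)) (∧-zeroʳ (p zero))
             (count-cong (λ y → ∧-identityʳ (p (suc y))) (allFin n)) ⟨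
  fromBool (p zero) + (fromBool ((p ∖ zero) zero) + size ((p ∖ zero) ∘ suc))
    ≡⟨ cong (fromBool (p zero) +_) (size-suc (p ∖ zero)) ⟨
  fromBool (p zero) + size (p ∖ zero)
    ∎
  where open ≡-Reasoning
size-∖ {suc n} p (suc x) = begin
  size p                                   ≡⟨ size-suc p ⟩
  p₀ + size (p ∘ suc)                      ≡⟨ cong (p₀ +_) (size-∖ (p ∘ suc) x) ⟩
  p₀ + (fromBool (p (suc x)) + rest)       ≡⟨ +-CS.x∙yz≈y∙xz p₀ (fromBool (p (suc x))) rest ⟩
  fromBool (p (suc x)) + (p₀ + rest)       ≡⟨ cong (λ b → fromBool (p (suc x)) + (fromBool b + rest)) (∧-identityʳ (p zero)) ⟨
  fromBool (p (suc x)) + (fromBool ((p ∖ suc x) zero) + rest)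
                                           ≡⟨ cong (fromBool (p (suc x)) +_) (size-suc (p ∖ suc x)) ⟨
  fromBool (p (suc x)) + size (p ∖ suc x)  ∎
  where
  open ≡-Reasoning
  p₀ rest : ℕ
  p₀ = fromBool (p zero)
  rest = size ((p ∖ suc x) ∘ suc)

size-∖∈ : {n : ℕ} {p : Fin n → Bool} {x : Fin n} → T (p x) → size p ∸ 1 ≡ size (p ∖ x)
size-∖∈ {p = p} {x} px = cong (_∸ 1) (trans (size-∖ p x) (cong (λ b → fromBool b + size (p ∖ x)) (Equivalence.to T-≡ px)))

∖⁻ : {n : ℕ} {p : Fin n → Bool} {x y : Fin n} → T ((p ∖ x) y) → T (p y) × y ≢ x
∖⁻ {p = p} {x} {y} py∖x with p y | y ≟ x
... | true | no y≢x = _ , y≢x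

∖⁺ : {n : ℕ} {p : Fin n → Bool} {x y : Fin n} → T (p y) → y ≢ x → T ((p ∖ x) y)
∖⁺ {p = p} {x} {y} py y≢x with p y | y ≟ x
... | true | yes y≡x = y≢x y≡x
... | true | no _    = _

size-∘-bijection : {a b : ℕ} (f : Fin a → Fin b) (g : Fin b → Fin a) →
  (∀ j → f (g j) ≡ j) → (∀ i → g (f i) ≡ i) → (q : Fin b → Bool) → size (q ∘ f) ≡ size q
size-∘-bijection {a} {b} f g f∘g g∘f q = ≤-antisym
  (count-≤-injection f (Unique.allFin⁺ a) ∈-allFin (λ _ _ → cancel {h⁻¹ = g} g∘f) id)
  (count-≤-injection g (Unique.allFin⁺ b) ∈-allFin (λ _ _ → cancel {h⁻¹ = f} f∘g)
    (λ {j} qj → subst (T ∘ q) (sym (f∘g j)) qj))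
  where
  cancel : {c d : ℕ} {h : Fin c → Fin d} {h⁻¹ : Fin d → Fin c} →
    (∀ i → h⁻¹ (h i) ≡ i) → ∀ {i j} → h i ≡ h j → i ≡ j
  cancel {h⁻¹ = h⁻¹} inverseˡ {i} {j} hi≡hj = trans (sym (inverseˡ i)) (trans (cong h⁻¹ hi≡hj) (inverseˡ j))

-- Injective vectors with a prescribed colour pattern

falling : ℕ → ℕ → ℕ
falling a zero    = 1
falling a (suc l) = a * falling (a ∸ 1) l

falling-! : (a : ℕ) → falling a a ≡ a !
falling-! zero    = refl
falling-! (suc a) = cong (suc a *_) (falling-! a)

falling-< : {a l : ℕ} → a < l → falling a l ≡ 0
falling-< {zero}  {suc l} _         = refl
falling-< {suc a} {suc l} (s≤s a<l) = trans (cong (suc a *_) (falling-< a<l)) (*-zeroʳ (suc a))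

trues falses : Vec Bool l → ℕ
trues  []      = 0
trues  (b ∷ c) = fromBool b + trues c
falses []      = 0
falses (b ∷ c) = fromBool (not b) + falses c

trues-replicate : (l : ℕ) (b : Bool) → trues (replicate l b) ≡ fromBool b * l
trues-replicate zero    b = sym (*-zeroʳ (fromBool b))
trues-replicate (suc l) b = trans (cong (fromBool b +_) (trues-replicate l b)) (sym (*-suc (fromBool b) l))

falses-replicate : (l : ℕ) (b : Bool) → falses (replicate l b) ≡ fromBool (not b) * l
falses-replicate zero    b = sym (*-zeroʳ (fromBool (not b)))
falses-replicate (suc l) b = trans (cong (fromBool (not b) +_) (falses-replicate l b)) (sym (*-suc (fromBool (not b)) l))

trues-++ : {a b : ℕ} (u : Vec Bool a) (w : Vec Bool b) → trues (u ++ᵛ w) ≡ trues u + trues w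
trues-++ []      w = refl
trues-++ (x ∷ u) w = trans (cong (fromBool x +_) (trues-++ u w)) (sym (+-assoc (fromBool x) _ _))

falses-++ : {a b : ℕ} (u : Vec Bool a) (w : Vec Bool b) → falses (u ++ᵛ w) ≡ falses u + falses w
falses-++ []      w = refl
falses-++ (x ∷ u) w = trans (cong (fromBool (not x) +_) (falses-++ u w)) (sym (+-assoc (fromBool (not x)) _ _))

module _ {N : ℕ} where

  -- τ lists distinct elements of P at the true positions of c and distinct elements of Q at
  -- the false ones; an element may occur in both classes.
  fits : (P Q : Fin N → Bool) → Vec Bool l → Vec (Fin N) l → Bool
  fits P Q []          []      = true
  fits P Q (true  ∷ c) (x ∷ τ) = P x ∧ fits (P ∖ x) Q c τ
  fits P Q (false ∷ c) (x ∷ τ) = Q x ∧ fits P (Q ∖ x) c τ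

  count-fits : (P Q : Fin N → Bool) (c : Vec Bool l) →
    count (fits P Q c) (allVecs (allFin N) l) ≡ falling (size P) (trues c) * falling (size Q) (falses c)
  count-fits P Q [] = refl
  count-fits {suc l} P Q (true ∷ c) = begin
    count (fits P Q (true ∷ c)) (allVecs (allFin N) (suc l))
      ≡⟨ count-allVecs-suc (fits P Q (true ∷ c)) (allFin N) ⟩
    sum (map (λ x → count (λ τ → P x ∧ fits (P ∖ x) Q c τ) (allVecs (allFin N) l)) (allFin N))
      ≡⟨ sum-count-∧ P (λ x → fits (P ∖ x) Q c) (allFin N) (allVecs (allFin N) l) tail-count ⟩
    size P * (falling (size P ∸ 1) (trues c) * falling (size Q) (falses c))
      ≡⟨ *-assoc (size P) _ _ ⟨
    falling (size P) (suc (trues c)) * falling (size Q) (falses c)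
      ∎
    where
    open ≡-Reasoning
    tail-count : ∀ x → T (P x) → count (fits (P ∖ x) Q c) (allVecs (allFin N) l)
                                 ≡ falling (size P ∸ 1) (trues c) * falling (size Q) (falses c)
    tail-count x Px = trans (count-fits (P ∖ x) Q c)
                              (cong (λ s → falling s (trues c) * falling (size Q) (falses c)) (sym (size-∖∈ {p = P} Px)))
  count-fits {suc l} P Q (false ∷ c) = begin
    count (fits P Q (false ∷ c)) (allVecs (allFin N) (suc l))
      ≡⟨ count-allVecs-suc (fits P Q (false ∷ c)) (allFin N) ⟩
    sum (map (λ x → count (λ τ → Q x ∧ fits P (Q ∖ x) c τ) (allVecs (allFin N) l)) (allFin N))
      ≡⟨ sum-count-∧ Q (λ x → fits P (Q ∖ x) c) (allFin N) (allVecs (allFin N) l) tail-count ⟩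
    size Q * (falling (size P) (trues c) * falling (size Q ∸ 1) (falses c))
      ≡⟨ x∙yz≈y∙xz (size Q) (falling (size P) (trues c)) _ ⟩
    falling (size P) (trues c) * falling (size Q) (suc (falses c))
      ∎
    where
    open ≡-Reasoning
    tail-count : ∀ x → T (Q x) → count (fits P (Q ∖ x) c) (allVecs (allFin N) l)
                                 ≡ falling (size P) (trues c) * falling (size Q ∸ 1) (falses c)
    tail-count x Qx = trans (count-fits P (Q ∖ x) c)
                              (cong (λ s → falling (size P) (trues c) * falling s (falses c)) (sym (size-∖∈ {p = Q} Qx)))

  fits-complete : (P Q : Fin N → Bool) (c : Vec Bool l) (τ : Vec (Fin N) l) →
    Injective _≡_ _≡_ (lookup τ) → (∀ i → T ((if lookup c i then P else Q) (lookup τ i))) →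
    T (fits P Q c τ)
  fits-complete P Q []          []      _   _      = _
  fits-complete P Q (true ∷ c)  (x ∷ τ) inj colour =
    T-∧⁺ (colour zero , fits-complete (P ∖ x) Q c τ (suc-injective ∘ inj) colour′)
    where
    colour′ : ∀ i → T ((if lookup c i then P ∖ x else Q) (lookup τ i))
    colour′ i with lookup c i | colour (suc i)
    ... | true  | Pτi = ∖⁺ {p = P} Pτi (λ τi≡x → 0≢1+n (sym (inj τi≡x)))
    ... | false | Qτi = Qτi
  fits-complete P Q (false ∷ c) (x ∷ τ) inj colour =
    T-∧⁺ (colour zero , fits-complete P (Q ∖ x) c τ (suc-injective ∘ inj) colour′)
    where
    colour′ : ∀ i → T ((if lookup c i then P else Q ∖ x) (lookup τ i))
    colour′ i with lookup c i | colour (suc i)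
    ... | true  | Pτi = Pτi
    ... | false | Qτi = ∖⁺ {p = Q} Qτi (λ τi≡x → 0≢1+n (sym (inj τi≡x)))

  fits-replicate⁻ : (P Q : Fin N → Bool) (τ : Vec (Fin N) l) → T (fits P Q (replicate l true) τ) →
    Injective _≡_ _≡_ (lookup τ) × (∀ i → T (P (lookup τ i)))
  fits-replicate⁻ P Q []      _ = (λ { {()} }) , λ ()
  fits-replicate⁻ P Q (x ∷ τ) h with T-∧⁻ h
  ... | Px , rest with fits-replicate⁻ (P ∖ x) Q τ rest
  ...   | τ-injective , τ⊆P∖x = x∷τ-injective , x∷τ⊆P
    where
    x∷τ-injective : Injective _≡_ _≡_ (lookup (x ∷ τ))
    x∷τ-injective {zero}  {zero}  _    = refl
    x∷τ-injective {zero}  {suc j} x≡τj = ⊥-elim (proj₂ (∖⁻ {p = P} (τ⊆P∖x j)) (sym x≡τj))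
    x∷τ-injective {suc i} {zero}  τi≡x = ⊥-elim (proj₂ (∖⁻ {p = P} (τ⊆P∖x i)) τi≡x)
    x∷τ-injective {suc i} {suc j} τi≡τj = cong suc (τ-injective τi≡τj)
    x∷τ⊆P : ∀ i → T (P (lookup (x ∷ τ) i))
    x∷τ⊆P zero    = Px
    x∷τ⊆P (suc i) = proj₁ (∖⁻ {p = P} (τ⊆P∖x i))

isMatching⇒injective : {a b : ℕ} (σ : Vec (Fin b) a) → T (isMatching σ) → Injective _≡_ _≡_ (lookup σ)
isMatching⇒injective {a} σ matching {i} {j} σi≡σj =
  entry (All.lookup (all⁺ (row i) (allFin a) (All.lookup (all⁺ _ (allFin a) matching) (∈-allFin i))) (∈-allFin j))
  where
  row : Fin a → Fin a → Bool
  row i j = does (i ≟ j) ∨ not (does (lookup σ i ≟ lookup σ j))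
  entry : T (row i j) → i ≡ j
  entry h with i ≟ j | lookup σ i ≟ lookup σ j
  ... | yes i≡j | _         = i≡j
  ... | no _    | no σi≢σj  = ⊥-elim (σi≢σj σi≡σj)

injective⇒isMatching : {a b : ℕ} (σ : Vec (Fin b) a) → Injective _≡_ _≡_ (lookup σ) → T (isMatching σ)
injective⇒isMatching {a} σ injective =
  all⁻ (λ i → all (row i) (allFin a)) {xs = allFin a}
    (All.tabulate (λ {i} _ → all⁻ (row i) {xs = allFin a} (All.tabulate (λ {j} _ → entry i j))))
  where
  row : Fin a → Fin a → Bool
  row i j = does (i ≟ j) ∨ not (does (lookup σ i ≟ lookup σ j))
  entry : ∀ i j → T (row i j)
  entry i j with i ≟ j | lookup σ i ≟ lookup σ j
  ... | yes _   | _         = _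
  ... | no i≢j  | yes σi≡σj = i≢j (injective σi≡σj)
  ... | no _    | no _      = _

injective⇒surjective : {n : ℕ} {f : Fin n → Fin n} → Injective _≡_ _≡_ f → ∀ j → ∃[ i ] f i ≡ j
injective⇒surjective {suc n} {f} f-injective j with any? (λ i → f i ≟ j)
... | yes found = found
... | no  ∄i    = contradiction (injective⇒≤ g-injective) 1+n≰n
  where
  g : Fin (suc n) → Fin n
  g i = punchOut {i = j} {j = f i} (λ j≡fi → ∄i (i , sym j≡fi))
  g-injective : Injective _≡_ _≡_ g
  g-injective gi≡gk = f-injective (punchOut-injective {i = j} _ _ gi≡gk)

-- The fallback j is a junk value: it is returned only if f misses j, impossible for injective f.
preimage : {n : ℕ} → (Fin n → Fin n) → Fin n → Fin n
preimage f j with any? (λ i → f i ≟ j)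
... | yes (i , _) = i
... | no  _       = j

preimage-section : {n : ℕ} {f : Fin n → Fin n} → Injective _≡_ _≡_ f → ∀ j → f (preimage f j) ≡ j
preimage-section {f = f} f-injective j with any? (λ i → f i ≟ j)
... | yes (_ , fi≡j) = fi≡j
... | no  ∄i         = ⊥-elim (∄i (injective⇒surjective f-injective j))

inverse : {a b : ℕ} → a ≡ b → Vec (Fin b) a → Vec (Fin a) b
inverse refl σ = tabulate (preimage (lookup σ))

module _ {a b : ℕ} (a≡b : a ≡ b) (σ : Vec (Fin b) a) (σ-injective : Injective _≡_ _≡_ (lookup σ)) where

  lookup-inverse : ∀ j → lookup σ (lookup (inverse a≡b σ) j) ≡ j
  lookup-inverse j = section a≡b
    where
    section : (e : a ≡ b) → lookup σ (lookup (inverse e σ) j) ≡ j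
    section refl = trans (cong (lookup σ) (lookup∘tabulate _ j)) (preimage-section σ-injective j)

  inverse-lookup : ∀ i → lookup (inverse a≡b σ) (lookup σ i) ≡ i
  inverse-lookup i = σ-injective (lookup-inverse (lookup σ i))

  inverse-injective : Injective _≡_ _≡_ (lookup (inverse a≡b σ))
  inverse-injective {j} {j′} e = trans (sym (lookup-inverse j)) (trans (cong (lookup σ) e) (lookup-inverse j′))

inverse-cancel : {a b : ℕ} (a≡b : a ≡ b) {σ σ′ : Vec (Fin b) a} →
  Injective _≡_ _≡_ (lookup σ) → Injective _≡_ _≡_ (lookup σ′) → inverse a≡b σ ≡ inverse a≡b σ′ → σ ≡ σ′
inverse-cancel a≡b {σ} {σ′} σ-injective σ′-injective inverses≡ =
  trans (sym (tabulate∘lookup σ)) (trans (tabulate-cong pointwise) (tabulate∘lookup σ′))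
  where
  pointwise : ∀ i → lookup σ i ≡ lookup σ′ i
  pointwise i = begin
    lookup σ i
      ≡⟨ cong (lookup σ) (inverse-lookup a≡b σ′ σ′-injective i) ⟨
    lookup σ (lookup (inverse a≡b σ′) (lookup σ′ i))
      ≡⟨ cong (λ τ → lookup σ (lookup τ (lookup σ′ i))) inverses≡ ⟨
    lookup σ (lookup (inverse a≡b σ) (lookup σ′ i))
      ≡⟨ lookup-inverse a≡b σ σ-injective (lookup σ′ i) ⟩
    lookup σ′ i
      ∎
    where open ≡-Reasoning

quotient-↑ˡ : (m k : ℕ) (i : Fin k) → quotient {suc m} k (i ↑ˡ m * k) ≡ zero
quotient-↑ˡ m k i rewrite splitAt-↑ˡ k i (m * k) = refl

quotient-↑ʳ : (m k : ℕ) (i : Fin (m * k)) → quotient {suc m} k (k ↑ʳ i) ≡ suc (quotient {m} k i)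
quotient-↑ʳ m k i rewrite splitAt-↑ʳ k (m * k) i = refl

size-const : (k : ℕ) (b : Bool) → size {k} (λ _ → b) ≡ fromBool b * k
size-const k true  = trans (size-true k) (sym (+-identityʳ k))
size-const k false = count-false (allFin k)

size-lookup : {k : ℕ} (u : Vec Bool k) → size (lookup u) ≡ trues u
size-lookup []      = refl
size-lookup (b ∷ u) = trans (size-suc (lookup (b ∷ u))) (cong (fromBool b +_) (size-lookup u))

size-quotient : {n : ℕ} (d : ℕ) (v : Vec Bool n) → size (λ i → lookup v (quotient d i)) ≡ trues v * d
size-quotient d []            = refl
size-quotient {suc n} d (b ∷ v) = begin
  size (λ i → lookup (b ∷ v) (quotient d i))
    ≡⟨ size-↑ d (n * d) _ ⟩
  size (λ i → lookup (b ∷ v) (quotient d (i ↑ˡ n * d))) + size (λ j → lookup (b ∷ v) (quotient d (d ↑ʳ j)))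
    ≡⟨ cong₂ _+_ (count-cong (λ i → cong (lookup (b ∷ v)) (quotient-↑ˡ n d i)) (allFin d))
                 (count-cong (λ j → cong (lookup (b ∷ v)) (quotient-↑ʳ n d j)) (allFin (n * d))) ⟩
  size {d} (λ _ → b) + size (λ j → lookup v (quotient d j))
    ≡⟨ cong₂ _+_ (size-const d b) (size-quotient d v) ⟩
  fromBool b * d + trues v * d
    ≡⟨ *-distribʳ-+ d (fromBool b) (trues v) ⟨
  trues (b ∷ v) * d
    ∎
  where open ≡-Reasoning

unitVectors : (k : ℕ) → List (Vec Bool k)
unitVectors zero    = []
unitVectors (suc k) = (true ∷ replicate k false) ∷ map (false ∷_) (unitVectors k)

length-unitVectors : (k : ℕ) → length (unitVectors k) ≡ k
length-unitVectors zero    = refl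
length-unitVectors (suc k) = cong suc (trans (length-map (false ∷_) (unitVectors k)) (length-unitVectors k))

trues≡0⇒replicate : {k : ℕ} (u : Vec Bool k) → trues u ≡ 0 → u ≡ replicate k false
trues≡0⇒replicate []          _      = refl
trues≡0⇒replicate (false ∷ u) trues≡0 = cong (false ∷_) (trues≡0⇒replicate u trues≡0)

trues≡1⇒∈unitVectors : {k : ℕ} (u : Vec Bool k) → trues u ≡ 1 → u ∈ unitVectors k
trues≡1⇒∈unitVectors (true  ∷ u) trues≡1 = here (cong (true ∷_) (trues≡0⇒replicate u (cong pred trues≡1)))
trues≡1⇒∈unitVectors (false ∷ u) trues≡1 = there (∈-map⁺ (false ∷_) (trues≡1⇒∈unitVectors u trues≡1))

unitVector-shape : {k : ℕ} {u : Vec Bool k} → u ∈ unitVectors k → trues u ≡ 1 × suc (falses u) ≡ k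
unitVector-shape {suc k} (here refl) = cong suc (trues-replicate k false) , cong suc (trans (falses-replicate k false) (+-identityʳ k))
unitVector-shape {suc k} (there u∈) with ∈-map⁻ (false ∷_) u∈
... | u′ , u′∈ , refl = map₂ (cong suc) (unitVector-shape u′∈)

blockPatterns : (m k : ℕ) → List (Vec Bool (m * k))
blockPatterns m k = map concat (allVecs (unitVectors k) m)

length-blockPatterns : (m k : ℕ) → length (blockPatterns m k) ≡ k ^ m
length-blockPatterns m k = begin
  length (map concat (allVecs (unitVectors k) m))   ≡⟨ length-map concat (allVecs (unitVectors k) m) ⟩
  length (allVecs (unitVectors k) m)                ≡⟨ length-allVecs (unitVectors k) m ⟩
  length (unitVectors k) ^ m                        ≡⟨ cong (_^ m) (length-unitVectors k) ⟩
  k ^ m                                             ∎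
  where open ≡-Reasoning

blockPattern-shape : {m k : ℕ} {c : Vec Bool (m * k)} → c ∈ blockPatterns m k → trues c ≡ m × falses c ≡ m * (k ∸ 1)
blockPattern-shape {m} {k} c∈ with ∈-map⁻ concat c∈
... | B , B∈ , refl = concat-shape B (∈-allVecs⁻ B∈)
  where
  concat-shape : {m : ℕ} (B : Vec (Vec Bool k) m) → (∀ i → lookup B i ∈ unitVectors k) →
                 trues (concat B) ≡ m × falses (concat B) ≡ m * (k ∸ 1)
  concat-shape []      _       = refl , refl
  concat-shape (u ∷ B) units with unitVector-shape (units zero) | concat-shape B (units ∘ suc)
  ... | u-trues , u-falses | B-trues , B-falses =
    trans (trues-++ u (concat B)) (cong₂ _+_ u-trues B-trues) ,
    trans (falses-++ u (concat B)) (cong₂ _+_ (cong (_∸ 1) u-falses) B-falses)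

size-block : {m k : ℕ} (B : Vec (Vec Bool k) m) (c : Fin m) →
  size {m * k} (λ j → does (quotient k j ≟ c) ∧ lookup (concat B) j) ≡ trues (lookup B c)
size-block {suc m} {k} (u ∷ B) c = begin
  size block                                               ≡⟨ size-↑ k (m * k) block ⟩
  size (block ∘ (_↑ˡ m * k)) + size (block ∘ (k ↑ʳ_))      ≡⟨ cong₂ _+_ (count-cong first (allFin k))
                                                                         (count-cong rest (allFin (m * k))) ⟩
  size (λ i → does (zero ≟ c) ∧ lookup u i) + size later   ≡⟨ by-block c ⟩
  trues (lookup (u ∷ B) c)                                 ∎
  where
  open ≡-Reasoning
  block : Fin (suc m * k) → Bool
  block j = does (quotient k j ≟ c) ∧ lookup (concat (u ∷ B)) j
  later : Fin (m * k) → Bool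
  later j = does (suc (quotient k j) ≟ c) ∧ lookup (concat B) j
  first : ∀ i → block (i ↑ˡ m * k) ≡ does (zero ≟ c) ∧ lookup u i
  first i = cong₂ (λ q b → does (q ≟ c) ∧ b) (quotient-↑ˡ m k i) (lookup-++ˡ u (concat B) i)
  rest : ∀ j → block (k ↑ʳ j) ≡ later j
  rest j = cong₂ (λ q b → does (q ≟ c) ∧ b) (quotient-↑ʳ m k j) (lookup-++ʳ u (concat B) j)
  by-block : (c : Fin (suc m)) →
    size (λ i → does (zero ≟ c) ∧ lookup u i) + size (λ j → does (suc (quotient k j) ≟ c) ∧ lookup (concat B) j)
    ≡ trues (lookup (u ∷ B) c)
  by-block zero    = trans (cong₂ _+_ (size-lookup u) (count-false (allFin (m * k)))) (+-identityʳ (trues u))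
  by-block (suc c) = trans (cong (_+ size (λ j → does (quotient k j ≟ c) ∧ lookup (concat B) j)) (count-false (allFin k)))
                           (size-block B c)

∈-blockPatterns : {m k : ℕ} (p : Vec Bool (m * k)) →
  (∀ c → size {m * k} (λ j → does (quotient k j ≟ c) ∧ lookup p j) ≡ 1) → p ∈ blockPatterns m k
∈-blockPatterns {m} {k} p one-per-block with group m k p
... | B , refl = ∈-map⁺ concat (∈-allVecs⁺ B one-unit-per-block)
  where
  one-unit-per-block : ∀ c → lookup B c ∈ unitVectors k
  one-unit-per-block c = trues≡1⇒∈unitVectors (lookup B c) (trans (sym (size-block B c)) (one-per-block c))

-- Binomial coefficients

nC0≡1 : (n : ℕ) → n C 0 ≡ 1
nC0≡1 n = trans (nCk≡nC[n∸k] {0} {n} z≤n) (nCn≡1 n)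

C*!*!≡! : {n i : ℕ} → i ≤ n → (n C i) * (i ! * (n ∸ i) !) ≡ n !
C*!*!≡! {n} {i} i≤n = trans (cong (_* (i ! * (n ∸ i) !)) (nCk≡n!/k![n-k]! i≤n)) (m/n*n≡m (k![n∸k]!∣n! i≤n))
  where instance _ = i !* (n ∸ i) !≢0

C-ratio : (n i : ℕ) → (n C suc i) * suc i ≡ (n C i) * (n ∸ i)
C-ratio n i with i <? n
... | no i≮n = begin
  (n C suc i) * suc i   ≡⟨ cong (_* suc i) (k>n⇒nCk≡0 (s≤s (≮⇒≥ i≮n))) ⟩
  0                     ≡⟨ *-zeroʳ (n C i) ⟨
  (n C i) * 0           ≡⟨ cong ((n C i) *_) (m≤n⇒m∸n≡0 (≮⇒≥ i≮n)) ⟨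
  (n C i) * (n ∸ i)     ∎
  where open ≡-Reasoning
... | yes i<n = *-cancelʳ-≡ _ _ (i ! * j !) {{i !* j !≢0}} (begin
  (n C suc i) * suc i * (i ! * j !)   ≡⟨ x*y*[z*w]≡x*[y*z*w] (n C suc i) (suc i) (i !) (j !) ⟩
  (n C suc i) * (suc i ! * j !)       ≡⟨ C*!*!≡! i<n ⟩
  n !                                 ≡⟨ C*!*!≡! (<⇒≤ i<n) ⟨
  (n C i) * (i ! * (n ∸ i) !)         ≡⟨ cong (λ l → (n C i) * (i ! * l !)) n∸i≡1+j ⟩
  (n C i) * (i ! * suc j !)           ≡⟨ x*[z*[y*w]]≡x*y*[z*w] (n C i) (suc j) (i !) (j !) ⟩
  (n C i) * suc j * (i ! * j !)       ≡⟨ cong (λ l → (n C i) * l * (i ! * j !)) n∸i≡1+j ⟨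
  (n C i) * (n ∸ i) * (i ! * j !)     ∎)
  where
  open ≡-Reasoning
  j : ℕ
  j = n ∸ suc i
  n∸i≡1+j : n ∸ i ≡ suc j
  n∸i≡1+j = +-∸-assoc 1 i<n
  x*y*[z*w]≡x*[y*z*w] : (x y z w : ℕ) → x * y * (z * w) ≡ x * (y * z * w)
  x*y*[z*w]≡x*[y*z*w] = solve-∀
  x*[z*[y*w]]≡x*y*[z*w] : (x y z w : ℕ) → x * (z * (y * w)) ≡ x * y * (z * w)
  x*[z*[y*w]]≡x*y*[z*w] = solve-∀

C[2+a,a]*2 : (a : ℕ) → (suc (suc a) C a) * 2 ≡ suc (suc a) * suc a
C[2+a,a]*2 a = begin
  (suc (suc a) C a) * 2                   ≡⟨ cong (_* 2) (nCk≡nC[n∸k] (m≤n+m a 2)) ⟩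
  (suc (suc a) C (suc (suc a) ∸ a)) * 2   ≡⟨ cong (λ i → (suc (suc a) C i) * 2) (m+n∸n≡m 2 a) ⟩
  (suc (suc a) C 2) * 2                   ≡⟨ C-ratio (suc (suc a)) 1 ⟩
  (suc (suc a) C 1) * suc a               ≡⟨ cong (_* suc a) (nC1≡n (suc (suc a))) ⟩
  suc (suc a) * suc a                     ∎
  where open ≡-Reasoning

C[n+nx,nx]≡C[n+nx,n] : (n x : ℕ) → (n * suc x) C (n * x) ≡ (n * suc x) C n
C[n+nx,nx]≡C[n+nx,n] n x = begin
  (n * suc x) C (n * x)                   ≡⟨ nCk≡nC[n∸k] (≤-trans (m≤n+m (n * x) n) (≤-reflexive (sym (*-suc n x)))) ⟩
  (n * suc x) C (n * suc x ∸ n * x)       ≡⟨ cong (λ l → (n * suc x) C (l ∸ n * x)) (*-suc n x) ⟩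
  (n * suc x) C (n + n * x ∸ n * x)       ≡⟨ cong ((n * suc x) C_) (m+n∸n≡m n (n * x)) ⟩
  (n * suc x) C n                         ∎
  where open ≡-Reasoning

×≡* : (a b : ℕ) → a Additive.× b ≡ a * b
×≡* zero    b = refl
×≡* (suc a) b = cong (b +_) (×≡* a b)

^≡^ : (x n : ℕ) → x Exp.^ n ≡ x ^ n
^≡^ x zero    = refl
^≡^ x (suc n) = cong (x *_) (^≡^ x n)

binomial-theorem : (n x : ℕ) → suc x ^ n ≡ ∑ (λ (i : Fin (suc n)) → (n C toℕ i) * x ^ toℕ i)
binomial-theorem n x = begin
  suc x ^ n                  ≡⟨ cong (_^ n) (+-comm 1 x) ⟩
  (x + 1) ^ n                ≡⟨ ^≡^ (x + 1) n ⟨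
  (x + 1) Exp.^ n            ≡⟨ Binomial.theorem n x 1 ⟩
  binomialExpansion x 1 n    ≡⟨ sum-cong-≗ {suc n} term ⟩
  ∑ {suc n} (λ i → (n C toℕ i) * x ^ toℕ i) ∎
  where
  open ≡-Reasoning
  term : (i : Fin (suc n)) → (n C toℕ i) Additive.× (x Exp.^ toℕ i * 1 Exp.^ (n ∸ toℕ i)) ≡ (n C toℕ i) * x ^ toℕ i
  term i = begin
    (n C toℕ i) Additive.× (x Exp.^ toℕ i * 1 Exp.^ (n ∸ toℕ i))
      ≡⟨ ×≡* (n C toℕ i) _ ⟩
    (n C toℕ i) * (x Exp.^ toℕ i * 1 Exp.^ (n ∸ toℕ i))
      ≡⟨ cong₂ (λ a b → (n C toℕ i) * (a * b))
               (^≡^ x (toℕ i)) (trans (^≡^ 1 (n ∸ toℕ i)) (^-zeroˡ (n ∸ toℕ i))) ⟩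
    (n C toℕ i) * (x ^ toℕ i * 1)
      ≡⟨ cong ((n C toℕ i) *_) (*-identityʳ (x ^ toℕ i)) ⟩
    (n C toℕ i) * x ^ toℕ i
      ∎

∑-term≤ : {n : ℕ} (f : Fin n → ℕ) (i : Fin n) → f i ≤ ∑ f
∑-term≤ f zero    = m≤m+n (f zero) _
∑-term≤ f (suc i) = ≤-trans (∑-term≤ (f ∘ suc) i) (m≤n+m _ (f zero))

∑≤*max : {n : ℕ} (f : Fin n → ℕ) {M : ℕ} → (∀ i → f i ≤ M) → ∑ f ≤ n * M
∑≤*max {zero}  f f≤M = z≤n
∑≤*max {suc n} f f≤M = +-mono-≤ (f≤M zero) (∑≤*max (f ∘ suc) (f≤M ∘ suc))

binomial-term≤ : (n i x : ℕ) → (n C i) * x ^ i ≤ suc x ^ n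
binomial-term≤ n i x with i ≤? n
... | yes i≤n = begin
  (n C i) * x ^ i          ≡⟨ cong (λ j → (n C j) * x ^ j) (toℕ-fromℕ< (s≤s i≤n)) ⟨
  (n C toℕ (fromℕ< (s≤s i≤n))) * x ^ toℕ (fromℕ< (s≤s i≤n))
                         ≤⟨ ∑-term≤ {suc n} (λ j → (n C toℕ j) * x ^ toℕ j) (fromℕ< (s≤s i≤n)) ⟩
  ∑ {suc n} (λ j → (n C toℕ j) * x ^ toℕ j) ≡⟨ binomial-theorem n x ⟨
  suc x ^ n              ∎
  where open ≤-Reasoning
... | no i≰n = ≤-trans (≤-reflexive (cong (_* x ^ i) (k>n⇒nCk≡0 (≰⇒> i≰n)))) z≤n

≤-peak : (f : ℕ → ℕ) (p : ℕ) → (∀ i → suc i ≤ p → f i ≤ f (suc i)) → (∀ i → p ≤ i → f (suc i) ≤ f i) →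
  ∀ i → f i ≤ f p
≤-peak f p up down i with ≤-total i p
... | inj₁ i≤p = ascend up i≤p
  where
  ascend : {p : ℕ} → (∀ i → suc i ≤ p → f i ≤ f (suc i)) → ∀ {i} → i ≤ p → f i ≤ f p
  ascend {zero}  up z≤n = ≤-refl
  ascend {suc p} up {i} i≤1+p with m≤n⇒m<n∨m≡n i≤1+p
  ... | inj₂ refl      = ≤-refl
  ... | inj₁ (s≤s i≤p) = ≤-trans (ascend (λ j 1+j≤p → up j (m≤n⇒m≤1+n 1+j≤p)) i≤p) (up p ≤-refl)
... | inj₂ p≤i = descend p≤i
  where
  descend : ∀ {i} → p ≤ i → f i ≤ f p
  descend {zero}  z≤n = ≤-refl
  descend {suc i} p≤1+i with m≤n⇒m<n∨m≡n p≤1+i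
  ... | inj₂ refl      = ≤-refl
  ... | inj₁ (s≤s p≤i) = ≤-trans (down i p≤i) (descend p≤i)

binomial-term-ratio : (K x i : ℕ) → (K C suc i) * x ^ suc i * suc i ≡ (K C i) * x ^ i * ((K ∸ i) * x)
binomial-term-ratio K x i = begin
  (K C suc i) * (x * x ^ i) * suc i   ≡⟨ xy∙z≈xz∙y (K C suc i) (x * x ^ i) (suc i) ⟩
  (K C suc i) * suc i * (x * x ^ i)   ≡⟨ cong (_* (x * x ^ i)) (C-ratio K i) ⟩
  (K C i) * (K ∸ i) * (x * x ^ i)     ≡⟨ x*y*[z*w]≡x*w*[y*z] (K C i) (K ∸ i) x (x ^ i) ⟩
  (K C i) * x ^ i * ((K ∸ i) * x)     ∎
  where
  open ≡-Reasoning
  x*y*[z*w]≡x*w*[y*z] : (a b c e : ℕ) → a * b * (c * e) ≡ a * e * (b * c)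
  x*y*[z*w]≡x*w*[y*z] = solve-∀

binomial-term≤maximal : (M x i : ℕ) → ((M * suc x) C i) * x ^ i ≤ ((M * suc x) C (M * x)) * x ^ (M * x)
binomial-term≤maximal M x = ≤-peak term (M * x) up down
  where
  open ≤-Reasoning
  K : ℕ
  K = M * suc x
  term : ℕ → ℕ
  term i = (K C i) * x ^ i
  up : ∀ i → suc i ≤ M * x → term i ≤ term (suc i)
  up i 1+i≤Mx = *-cancelʳ-≤ (term i) (term (suc i)) (suc i) (begin
    term i * suc i                 ≤⟨ *-monoʳ-≤ (term i) (≤-trans 1+i≤Mx (*-monoˡ-≤ x (≤-trans (n≤1+n M) 1+M≤K∸i))) ⟩
    term i * ((K ∸ i) * x)         ≡⟨ binomial-term-ratio K x i ⟨
    term (suc i) * suc i           ∎)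
    where
    1+M≤K∸i : suc M ≤ K ∸ i
    1+M≤K∸i = m+n≤o⇒m≤o∸n (suc M) (begin
      suc M + i      ≡⟨ +-comm (suc M) i ⟩
      i + suc M      ≡⟨ +-suc i M ⟩
      suc i + M      ≤⟨ +-monoˡ-≤ M 1+i≤Mx ⟩
      M * x + M      ≡⟨ +-comm (M * x) M ⟩
      M + M * x      ≡⟨ *-suc M x ⟨
      K              ∎)
  down : ∀ i → M * x ≤ i → term (suc i) ≤ term i
  down i Mx≤i = *-cancelʳ-≤ (term (suc i)) (term i) (suc i) (begin
    term (suc i) * suc i           ≡⟨ binomial-term-ratio K x i ⟩
    term i * ((K ∸ i) * x)         ≤⟨ *-monoʳ-≤ (term i) (≤-trans (*-monoˡ-≤ x K∸i≤M) (≤-trans Mx≤i (n≤1+n i))) ⟩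
    term i * suc i                 ∎)
    where
    K∸i≤M : K ∸ i ≤ M
    K∸i≤M = begin
      K ∸ i              ≤⟨ ∸-monoʳ-≤ K Mx≤i ⟩
      K ∸ M * x          ≡⟨ cong (_∸ M * x) (*-suc M x) ⟩
      M + M * x ∸ M * x  ≡⟨ m+n∸n≡m M (M * x) ⟩
      M                  ∎

binomial≤maximalTerm : (M x : ℕ) →
  suc x ^ (M * suc x) ≤ suc (M * suc x) * (((M * suc x) C (M * x)) * x ^ (M * x))
binomial≤maximalTerm M x = begin
  suc x ^ K                                       ≡⟨ binomial-theorem K x ⟩
  ∑ {suc K} (λ i → (K C toℕ i) * x ^ toℕ i)       ≤⟨ ∑≤*max {suc K} _ (λ i → binomial-term≤maximal M x (toℕ i)) ⟩
  suc K * ((K C (M * x)) * x ^ (M * x))           ∎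
  where
  open ≤-Reasoning
  K : ℕ
  K = M * suc x

^-distribʳ-* : (a b n : ℕ) → (a * b) ^ n ≡ a ^ n * b ^ n
^-distribʳ-* a b zero    = refl
^-distribʳ-* a b (suc n) = trans (cong (a * b *_) (^-distribʳ-* a b n)) (interchange a b (a ^ n) (b ^ n))

-- X^t ≥ (1 + Y)^t ≥ C(t, 2) Y^(t-2), and C(t, 2) is quadratic in t while c (1 + tD) Y² is linear.
exponential-dominates : (c D Y X : ℕ) → 1 ≤ Y → Y < X → ∃[ t₀ ] (∀ t → t₀ ≤ t → c * suc (t * D) * Y ^ t < X ^ t)
exponential-dominates c D Y X 1≤Y Y<X = suc (suc C₀) , dominates
  where
  C₀ : ℕ
  C₀ = 2 * c * suc D * (Y * Y)
  dominates : ∀ t → suc (suc C₀) ≤ t → c * suc (t * D) * Y ^ t < X ^ t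
  dominates t@(suc (suc a)) (s≤s (s≤s C₀≤a)) = *-cancelˡ-< 2 _ _ (begin-strict
    2 * (c * suc (t * D) * Y ^ t)            ≡⟨ regroup c (suc (t * D)) Y (Y ^ a) ⟩
    2 * c * suc (t * D) * (Y * Y) * Y ^ a    ≤⟨ *-monoˡ-≤ (Y ^ a) (*-monoˡ-≤ (Y * Y) (*-monoʳ-≤ (2 * c) 1+tD≤t[1+D])) ⟩
    2 * c * (t * suc D) * (Y * Y) * Y ^ a    ≡⟨ cong (_* Y ^ a) (pull-t (2 * c) t (suc D) (Y * Y)) ⟩
    C₀ * t * Y ^ a                           <⟨ *-monoˡ-< (Y ^ a) {{m^n≢0 Y a}} (*-monoˡ-< t (s≤s C₀≤a)) ⟩
    suc a * t * Y ^ a                        ≡⟨ cong (_* Y ^ a) (*-comm (suc a) t) ⟩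
    t * suc a * Y ^ a                        ≡⟨ cong (_* Y ^ a) (C[2+a,a]*2 a) ⟨
    (t C a) * 2 * Y ^ a                      ≡⟨ xy∙z≈y∙xz (t C a) 2 (Y ^ a) ⟩
    2 * ((t C a) * Y ^ a)                    ≤⟨ *-monoʳ-≤ 2 (binomial-term≤ t a Y) ⟩
    2 * suc Y ^ t                            ≤⟨ *-monoʳ-≤ 2 (^-monoˡ-≤ t Y<X) ⟩
    2 * X ^ t                                ∎)
    where
    open ≤-Reasoning
    instance
      _ : NonZero Y
      _ = >-nonZero 1≤Y
    1+tD≤t[1+D] : suc (t * D) ≤ t * suc D
    1+tD≤t[1+D] = ≤-trans (+-monoˡ-≤ (t * D) (s≤s (z≤n {suc a}))) (≤-reflexive (sym (*-suc t D)))
    regroup : (c s y z : ℕ) → 2 * (c * s * (y * (y * z))) ≡ 2 * c * s * (y * y) * z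
    regroup = solve-∀
    pull-t : (a b c e : ℕ) → a * (b * c) * e ≡ a * c * e * b
    pull-t = solve-∀

module _ (x d₁ t : ℕ) .{{_ : NonZero x}} where

  private
    k m e : ℕ
    k = suc x
    m = t * suc d₁
    e = d₁ * x

  binomialRatio< : (c : ℕ) → c * suc (t * (suc d₁ * k)) * (k * x ^ e) ^ t < (k ^ e) ^ t →
    c * ((t * k) C t) * k ^ m < (m * k) C m
  binomialRatio< c dominated = *-cancelʳ-< W _ _ (begin-strict
    c * Bt * k ^ m * W
      ≡⟨ regroup₁ c Bt (k ^ m) P R Q U ⟩
    (c * P * R * k ^ m * U) * (Bt * Q)
      ≤⟨ *-monoʳ-≤ (c * P * R * k ^ m * U) upper ⟩
    (c * P * R * k ^ m * U) * k ^ (t * k)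
      ≡⟨ cong (λ R → (c * P * R * k ^ m * U) * k ^ (t * k)) R≡Q*z ⟩
    (c * P * (Q * z) * k ^ m * U) * k ^ (t * k)
      ≡⟨ regroup₂ c P Q z (k ^ m) U (k ^ (t * k)) ⟩
    (c * P * (U * z)) * (Q * (k ^ m * k ^ (t * k)))
      ≡⟨ cong₂ (λ Yt K → (c * P * Yt) * (Q * K)) (^-distribʳ-* k (x ^ e) t) (^-distribˡ-+-* k m (t * k)) ⟨
    (c * P * (k * x ^ e) ^ t) * (Q * k ^ (m + t * k))
      <⟨ *-monoˡ-< (Q * k ^ (m + t * k)) {{m*n≢0 Q _ {{m^n≢0 x (t * x)}} {{m^n≢0 k (m + t * k)}}}} dominated′ ⟩
    (k ^ e) ^ t * (Q * k ^ (m + t * k))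
      ≡⟨ exponents ⟩
    k ^ (m * k) * (Q * U)
      ≤⟨ *-monoˡ-≤ (Q * U) lower ⟩
    P * (Bm * R) * (Q * U)
      ≡⟨ regroup₃ P Bm R Q U ⟩
    Bm * W
      ∎)
    where
    open ≤-Reasoning
    Bt Bm P R Q U z W : ℕ
    Bt = (t * k) C t
    Bm = (m * k) C m
    P = suc (m * k)
    R = x ^ (m * x)
    Q = x ^ (t * x)
    U = k ^ t
    z = (x ^ e) ^ t
    W = P * R * Q * U
    instance
      _ : NonZero W
      _ = m*n≢0 (P * R * Q) U {{m*n≢0 (P * R) Q {{m*n≢0 P R {{_}} {{m^n≢0 x (m * x)}}}} {{m^n≢0 x (t * x)}}}} {{m^n≢0 k t}}
    dominated′ : c * P * (k * x ^ e) ^ t < (k ^ e) ^ t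
    dominated′ = subst (λ l → c * suc l * (k * x ^ e) ^ t < (k ^ e) ^ t) (sym (*-assoc t (suc d₁) k)) dominated
    upper : Bt * Q ≤ k ^ (t * k)
    upper = subst (λ B → B * Q ≤ k ^ (t * k)) (C[n+nx,nx]≡C[n+nx,n] t x) (binomial-term≤ (t * k) (t * x) x)
    lower : k ^ (m * k) ≤ P * (Bm * R)
    lower = subst (λ B → k ^ (m * k) ≤ P * (B * R)) (C[n+nx,nx]≡C[n+nx,n] m x) (binomial≤maximalTerm m x)
    R≡Q*z : R ≡ Q * z
    R≡Q*z = begin-equality
      x ^ (m * x)            ≡⟨ cong (x ^_) (mx≡tx+et t d₁ x) ⟩
      x ^ (t * x + e * t)    ≡⟨ ^-distribˡ-+-* x (t * x) (e * t) ⟩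
      Q * x ^ (e * t)        ≡⟨ cong (Q *_) (^-*-assoc x e t) ⟨
      Q * z                  ∎
      where
      mx≡tx+et : (t d₁ x : ℕ) → t * suc d₁ * x ≡ t * x + d₁ * x * t
      mx≡tx+et = solve-∀
    exponents : (k ^ e) ^ t * (Q * k ^ (m + t * k)) ≡ k ^ (m * k) * (Q * U)
    exponents = begin-equality
      (k ^ e) ^ t * (Q * k ^ (m + t * k))   ≡⟨ cong (_* (Q * k ^ (m + t * k))) (^-*-assoc k e t) ⟩
      k ^ (e * t) * (Q * k ^ (m + t * k))   ≡⟨ x∙yz≈y∙xz (k ^ (e * t)) Q (k ^ (m + t * k)) ⟩
      Q * (k ^ (e * t) * k ^ (m + t * k))   ≡⟨ cong (Q *_) (^-distribˡ-+-* k (e * t) (m + t * k)) ⟨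
      Q * k ^ (e * t + (m + t * k))         ≡⟨ cong (λ n → Q * k ^ n) (exponent t d₁ x) ⟩
      Q * k ^ (m * k + t)                   ≡⟨ cong (Q *_) (^-distribˡ-+-* k (m * k) t) ⟩
      Q * (k ^ (m * k) * U)                 ≡⟨ x∙yz≈y∙xz Q (k ^ (m * k)) U ⟩
      k ^ (m * k) * (Q * U)                 ∎
      where
      exponent : (t d₁ x : ℕ) → d₁ * x * t + (t * suc d₁ + t * suc x) ≡ t * suc d₁ * suc x + t
      exponent = solve-∀
    regroup₁ : (c Bt K P R Q U : ℕ) → c * Bt * K * (P * R * Q * U) ≡ (c * P * R * K * U) * (Bt * Q)
    regroup₁ = solve-∀
    regroup₂ : (c P Q z K U L : ℕ) → (c * P * (Q * z) * K * U) * L ≡ (c * P * (U * z)) * (Q * (K * L))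
    regroup₂ = solve-∀
    regroup₃ : (P Bm R Q U : ℕ) → P * (Bm * R) * (Q * U) ≡ Bm * (P * R * Q * U)
    regroup₃ = solve-∀

-- The first moment

sum-allVecs-trues : (n t : ℕ) (g : ℕ → ℕ) → (∀ j → j ≤ n → j ≢ t → g j ≡ 0) →
  sum (map (g ∘ trues) (allVecs (true ∷ false ∷ []) n)) ≡ (n C t) * g t
sum-allVecs-trues zero zero    g vanish = trans (+-identityʳ (g 0)) (sym (trans (cong (_* g 0) (nC0≡1 0)) (*-identityˡ (g 0))))
sum-allVecs-trues zero (suc t) g vanish = trans (+-identityʳ (g 0)) (vanish 0 z≤n (λ ()))
sum-allVecs-trues (suc n) t g vanish = begin
  sum (map (g ∘ trues) (map (true ∷_) V ++ (map (false ∷_) V ++ [])))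
    ≡⟨ cong sum (map-++ (g ∘ trues) (map (true ∷_) V) _) ⟩
  sum (map (g ∘ trues) (map (true ∷_) V) ++ map (g ∘ trues) (map (false ∷_) V ++ []))
    ≡⟨ sum-++ (map (g ∘ trues) (map (true ∷_) V)) _ ⟩
  sum (map (g ∘ trues) (map (true ∷_) V)) + sum (map (g ∘ trues) (map (false ∷_) V ++ []))
    ≡⟨ cong₂ (λ xs ys → sum xs + sum ys) (sym (map-∘ V))
             (trans (cong (map (g ∘ trues)) (++-identityʳ _)) (sym (map-∘ V))) ⟩
  sum (map (g ∘ suc ∘ trues) V) + sum (map (g ∘ trues) V)
    ≡⟨ pascal t vanish ⟩
  (suc n C t) * g t
    ∎
  where
  open ≡-Reasoning
  V : List (Vec Bool n)
  V = allVecs (true ∷ false ∷ []) n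
  pascal : (t : ℕ) → (∀ j → j ≤ suc n → j ≢ t → g j ≡ 0) →
    sum (map (g ∘ suc ∘ trues) V) + sum (map (g ∘ trues) V) ≡ (suc n C t) * g t
  pascal zero vanish = begin
    sum (map (g ∘ suc ∘ trues) V) + sum (map (g ∘ trues) V)
      ≡⟨ cong₂ _+_ (sum-allVecs-trues n 0 (g ∘ suc) (λ j j≤n _ → vanish (suc j) (s≤s j≤n) (λ ())))
                   (sum-allVecs-trues n 0 g (λ j j≤n → vanish j (m≤n⇒m≤1+n j≤n))) ⟩
    (n C 0) * g 1 + (n C 0) * g 0
      ≡⟨ cong (λ x → (n C 0) * x + (n C 0) * g 0) (vanish 1 (s≤s z≤n) (λ ())) ⟩
    (n C 0) * 0 + (n C 0) * g 0
      ≡⟨ cong₂ (λ a b → a * 0 + b * g 0) (nC0≡1 n) (trans (nC0≡1 n) (sym (nC0≡1 (suc n)))) ⟩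
    (suc n C 0) * g 0
      ∎
  pascal (suc t) vanish = begin
    sum (map (g ∘ suc ∘ trues) V) + sum (map (g ∘ trues) V)
      ≡⟨ cong₂ _+_ (sum-allVecs-trues n t (g ∘ suc) (λ j j≤n j≢t → vanish (suc j) (s≤s j≤n) (j≢t ∘ cong pred)))
                   (sum-allVecs-trues n (suc t) g (λ j j≤n → vanish j (m≤n⇒m≤1+n j≤n))) ⟩
    (n C t) * g (suc t) + (n C suc t) * g (suc t)
      ≡⟨ *-distribʳ-+ (g (suc t)) (n C t) (n C suc t) ⟨
    (n C t + n C suc t) * g (suc t)
      ≡⟨ cong (_* g (suc t)) (nCk+nC[k+1]≡[n+1]C[k+1] n t) ⟩
    (suc n C suc t) * g (suc t)
      ∎

m*k∸m≡m*[k∸1] : (m k : ℕ) → m * k ∸ m ≡ m * (k ∸ 1)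
m*k∸m≡m*[k∸1] m k = trans (cong (m * k ∸_) (sym (*-identityʳ m))) (sym (*-distribˡ-∸ m k 1))

-- For an assignment with j variables: choose in each clause the copy that meets the assignment,
-- then match injectively the j·d copies of its variables and the remaining ones.
satisfyingMatchingsBound : (n d k m j : ℕ) → ℕ
satisfyingMatchingsBound n d k m j = k ^ m * (falling (j * d) m * falling (n * d ∸ j * d) (m * (k ∸ 1)))

module _ (n d k : ℕ) .{{_ : NonZero k}} (nd≡mk : n * d ≡ clauses n d k * k) where

  private
    m : ℕ
    m = clauses n d k
    Configs : List (Config n d k)
    Configs = allVecs (allFin (m * k)) (n * d)
    Inverses : List (Vec (Fin (n * d)) (m * k))
    Inverses = allVecs (allFin (n * d)) (m * k)

  copiesIn : Vec Bool n → Fin (n * d) → Bool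
  copiesIn A i = lookup A (quotient d i)

  inverse-blockPattern : (A : Vec Bool n) {σ : Config n d k} (σ-injective : Injective _≡_ _≡_ (lookup σ)) →
    T (satisfies n d k σ A) → Vec.map (copiesIn A) (inverse nd≡mk σ) ∈ blockPatterns m k
  inverse-blockPattern A {σ} σ-injective sat = ∈-blockPatterns (Vec.map (copiesIn A) τ) one-per-block
    where
    open ≡-Reasoning
    τ : Vec (Fin (n * d)) (m * k)
    τ = inverse nd≡mk σ
    one-per-block : ∀ c → size (λ j → does (quotient k j ≟ c) ∧ lookup (Vec.map (copiesIn A) τ) j) ≡ 1
    one-per-block c = begin
      size (λ j → does (quotient k j ≟ c) ∧ lookup (Vec.map (copiesIn A) τ) j)
        ≡⟨ size-∘-bijection (lookup σ) (lookup τ) (lookup-inverse nd≡mk σ σ-injective)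
                            (inverse-lookup nd≡mk σ σ-injective) _ ⟨
      size (λ i → does (quotient k (lookup σ i) ≟ c) ∧ lookup (Vec.map (copiesIn A) τ) (lookup σ i))
        ≡⟨ count-cong (λ i → cong (does (quotient k (lookup σ i) ≟ c) ∧_) (colour-of-σi i)) (allFin (n * d)) ⟩
      size (λ i → does (quotient k (lookup σ i) ≟ c) ∧ copiesIn A i)
        ≡⟨ ≡ᵇ⇒≡ _ 1 (All.lookup (all⁺ _ (allFin m) sat) (∈-allFin c)) ⟩
      1 ∎
      where
      colour-of-σi : ∀ i → lookup (Vec.map (copiesIn A) τ) (lookup σ i) ≡ copiesIn A i
      colour-of-σi i = trans (lookup-map (lookup σ i) (copiesIn A) τ) (cong (copiesIn A) (inverse-lookup nd≡mk σ σ-injective i))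

  inverse-fits-blockPattern : (A : Vec Bool n) {σ : Config n d k} → T (isMatching σ ∧ satisfies n d k σ A) →
    T (any (λ c → fits (copiesIn A) (not ∘ copiesIn A) c (inverse nd≡mk σ)) (blockPatterns m k))
  inverse-fits-blockPattern A {σ} matching∧sat with T-∧⁻ {isMatching σ} matching∧sat
  ... | matching , sat = any⁺ _ (Any.map (λ { refl → fits-own-colours }) (inverse-blockPattern A σ-injective sat))
    where
    S : Fin (n * d) → Bool
    S = copiesIn A
    τ : Vec (Fin (n * d)) (m * k)
    τ = inverse nd≡mk σ
    σ-injective : Injective _≡_ _≡_ (lookup σ)
    σ-injective = isMatching⇒injective σ matching
    own-colour : (y : Fin (n * d)) → T ((if S y then S else not ∘ S) y)
    own-colour y with S y in Sy
    ... | true  = subst T (sym Sy) _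
    ... | false = subst (T ∘ not) (sym Sy) _
    fits-own-colours : T (fits S (not ∘ S) (Vec.map S τ) τ)
    fits-own-colours = fits-complete S (not ∘ S) (Vec.map S τ) τ (inverse-injective nd≡mk σ σ-injective)
      (λ i → subst (λ b → T ((if b then S else not ∘ S) (lookup τ i))) (sym (lookup-map i S τ)) (own-colour (lookup τ i)))

  satisfyingMatchings≤ : (A : Vec Bool n) →
    count (λ σ → isMatching σ ∧ satisfies n d k σ A) Configs ≤ satisfyingMatchingsBound n d k m (trues A)
  satisfyingMatchings≤ A = begin
    count (λ σ → isMatching σ ∧ satisfies n d k σ A) Configs
      ≤⟨ count-≤-injection (inverse nd≡mk) (allVecs-unique (Unique.allFin⁺ (m * k)) (n * d))
           (λ τ → ∈-allVecs⁺ τ (λ i → ∈-allFin (lookup τ i))) inverse-cancel′ (inverse-fits-blockPattern A) ⟩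
    count (λ τ → any (λ c → fits S (not ∘ S) c τ) (blockPatterns m k)) Inverses
      ≤⟨ count-any≤sum (λ τ c → fits S (not ∘ S) c τ) Inverses (blockPatterns m k) ⟩
    sum (map (λ c → count (fits S (not ∘ S) c) Inverses) (blockPatterns m k))
      ≡⟨ sum-map-const (All.tabulate pattern-count) ⟩
    length (blockPatterns m k) * (falling (size S) m * falling (size (not ∘ S)) (m * (k ∸ 1)))
      ≡⟨ cong (λ s → length (blockPatterns m k) * (falling (size S) m * falling s (m * (k ∸ 1)))) (size-not S) ⟩
    length (blockPatterns m k) * (falling (size S) m * falling (n * d ∸ size S) (m * (k ∸ 1)))
      ≡⟨ cong₂ (λ p s → p * (falling s m * falling (n * d ∸ s) (m * (k ∸ 1))))
               (length-blockPatterns m k) (size-quotient d A) ⟩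
    satisfyingMatchingsBound n d k m (trues A)
      ∎
    where
    open ≤-Reasoning
    S : Fin (n * d) → Bool
    S = copiesIn A
    pattern-count : ∀ {c} → c ∈ blockPatterns m k →
      count (fits S (not ∘ S) c) Inverses ≡ falling (size S) m * falling (size (not ∘ S)) (m * (k ∸ 1))
    pattern-count {c} c∈ with blockPattern-shape {m} {k} c∈
    ... | trues≡m , falses≡ = trans (count-fits S (not ∘ S) c)
                                     (cong₂ (λ t f → falling (size S) t * falling (size (not ∘ S)) f) trues≡m falses≡)
    injective : {σ : Config n d k} → T (isMatching σ ∧ satisfies n d k σ A) → Injective _≡_ _≡_ (lookup σ)
    injective {σ} sat = isMatching⇒injective σ (proj₁ (T-∧⁻ sat))
    inverse-cancel′ : ∀ {σ σ′} → T (isMatching σ ∧ satisfies n d k σ A) →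
      T (isMatching σ′ ∧ satisfies n d k σ′ A) → inverse nd≡mk σ ≡ inverse nd≡mk σ′ → σ ≡ σ′
    inverse-cancel′ {σ} {σ′} sat sat′ = inverse-cancel nd≡mk {σ} {σ′} (injective {σ} sat) (injective {σ′} sat′)

  numMatchings≥ : (m * k) ! ≤ numMatchings n d k
  numMatchings≥ = begin
    (m * k) !
      ≡⟨ falling-! (m * k) ⟨
    falling (m * k) (m * k)
      ≡⟨ cong (falling (m * k)) nd≡mk ⟨
    falling (m * k) (n * d)
      ≡⟨ *-identityʳ _ ⟨
    falling (m * k) (n * d) * 1
      ≡⟨ cong₂ (λ s t → falling s t * 1) (size-true (m * k)) (+-identityʳ (n * d)) ⟨
    falling (size ⊤) (1 * (n * d)) * 1
      ≡⟨ cong₂ (λ t f → falling (size ⊤) t * falling (size ⊤) f)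
               (trues-replicate (n * d) true) (falses-replicate (n * d) true) ⟨
    falling (size ⊤) (trues (replicate (n * d) true)) * falling (size ⊤) (falses (replicate (n * d) true))
      ≡⟨ count-fits ⊤ ⊤ (replicate (n * d) true) ⟨
    count (fits ⊤ ⊤ (replicate (n * d) true)) Configs
      ≤⟨ count-mono (λ {σ} fits-σ → injective⇒isMatching σ (proj₁ (fits-replicate⁻ ⊤ ⊤ σ fits-σ))) Configs ⟩
    numMatchings n d k
      ∎
    where
    open ≤-Reasoning
    ⊤ : Fin (m * k) → Bool
    ⊤ _ = true

  numSatMatchings≤sum :
    numSatMatchings n d k ≤ sum (map (satisfyingMatchingsBound n d k m ∘ trues) (allVecs (true ∷ false ∷ []) n))
  numSatMatchings≤sum = begin
    numSatMatchings n d k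
      ≤⟨ count-mono (λ {σ} → ∧-any (isMatching σ) (satisfies n d k σ) (allVecs (true ∷ false ∷ []) n)) Configs ⟩
    count (λ σ → any (λ A → isMatching σ ∧ satisfies n d k σ A) (allVecs (true ∷ false ∷ []) n)) Configs
      ≤⟨ count-any≤sum (λ σ A → isMatching σ ∧ satisfies n d k σ A) Configs (allVecs (true ∷ false ∷ []) n) ⟩
    sum (map (λ A → count (λ σ → isMatching σ ∧ satisfies n d k σ A) Configs) (allVecs (true ∷ false ∷ []) n))
      ≤⟨ sum-map-mono satisfyingMatchings≤ (allVecs (true ∷ false ∷ []) n) ⟩
    sum (map (satisfyingMatchingsBound n d k m ∘ trues) (allVecs (true ∷ false ∷ []) n))
      ∎
    where open ≤-Reasoning

  satisfyingMatchingsBound-vanishes : ∀ {j} → j ≤ n → j * d ≢ m → satisfyingMatchingsBound n d k m j ≡ 0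
  satisfyingMatchingsBound-vanishes {j} j≤n jd≢m with <-cmp (j * d) m
  ... | tri< jd<m _ _ = begin-equality
    k ^ m * (falling (j * d) m * rest)   ≡⟨ cong (λ x → k ^ m * (x * rest)) (falling-< jd<m) ⟩
    k ^ m * 0                            ≡⟨ *-zeroʳ (k ^ m) ⟩
    0                                    ∎
    where
    open ≤-Reasoning
    rest : ℕ
    rest = falling (n * d ∸ j * d) (m * (k ∸ 1))
  ... | tri≈ _ jd≡m _ = contradiction jd≡m jd≢m
  ... | tri> _ _ jd>m = begin-equality
    k ^ m * (falling (j * d) m * falling (n * d ∸ j * d) (m * (k ∸ 1)))
      ≡⟨ cong (λ x → k ^ m * (falling (j * d) m * x)) (falling-< nd∸jd<m[k∸1]) ⟩
    k ^ m * (falling (j * d) m * 0)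
      ≡⟨ trans (cong (k ^ m *_) (*-zeroʳ (falling (j * d) m))) (*-zeroʳ (k ^ m)) ⟩
    0
      ∎
    where
    open ≤-Reasoning
    nd∸jd<m[k∸1] : n * d ∸ j * d < m * (k ∸ 1)
    nd∸jd<m[k∸1] = begin-strict
      n * d ∸ j * d   <⟨ ∸-monoʳ-< jd>m (*-monoˡ-≤ d j≤n) ⟩
      n * d ∸ m       ≡⟨ cong (_∸ m) nd≡mk ⟩
      m * k ∸ m       ≡⟨ m*k∸m≡m*[k∸1] m k ⟩
      m * (k ∸ 1)     ∎

  numSatMatchings≤C*bound : (t : ℕ) → (∀ {j} → j ≤ n → j * d ≡ m → j ≡ t) →
    numSatMatchings n d k ≤ (n C t) * satisfyingMatchingsBound n d k m t
  numSatMatchings≤C*bound t unique = ≤-trans numSatMatchings≤sum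
    (≤-reflexive (sum-allVecs-trues n t _ (λ j j≤n j≢t → satisfyingMatchingsBound-vanishes j≤n (j≢t ∘ unique j≤n))))

k∣dn⇒nd≡mk : (n d k : ℕ) .{{_ : NonZero k}} → k ∣ d * n → n * d ≡ clauses n d k * k
k∣dn⇒nd≡mk n d k k∣dn = sym (m/n*n≡m (subst (k ∣_) (*-comm d n) k∣dn))

numSatMatchings≡0 : (n d k : ℕ) .{{_ : NonZero k}} .{{_ : NonZero d}} → k ∣ d * n → ¬ k ∣ n → numSatMatchings n d k ≡ 0
numSatMatchings≡0 n d k k∣dn k∤n = n≤0⇒n≡0 (begin
  numSatMatchings n d k
    ≤⟨ numSatMatchings≤C*bound n d k nd≡mk 0 (λ {j} _ jd≡m → contradiction (k∣n {j} jd≡m) k∤n) ⟩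
  (n C 0) * satisfyingMatchingsBound n d k m 0
    ≡⟨ cong ((n C 0) *_) (satisfyingMatchingsBound-vanishes n d k nd≡mk z≤n (k∤n ∘ k∣n {0})) ⟩
  (n C 0) * 0
    ≡⟨ *-zeroʳ (n C 0) ⟩
  0
    ∎)
  where
  open ≤-Reasoning
  m : ℕ
  m = clauses n d k
  nd≡mk : n * d ≡ m * k
  nd≡mk = k∣dn⇒nd≡mk n d k k∣dn
  k∣n : ∀ {j} → j * d ≡ m → k ∣ n
  k∣n {j} jd≡m = divides j (*-cancelʳ-≡ n (j * k) d (begin-equality
    n * d       ≡⟨ nd≡mk ⟩
    m * k       ≡⟨ cong (_* k) jd≡m ⟨
    j * d * k   ≡⟨ xy∙z≈xz∙y j d k ⟩
    j * k * d   ∎))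

clauses-multiple : (t d k : ℕ) .{{_ : NonZero k}} → clauses (t * k) d k ≡ t * d
clauses-multiple t d k = trans (cong (_/ k) (xy∙z≈xz∙y t k d)) (m*n/n≡m (t * d) k)

multiple-nd≡mk : (t d k : ℕ) .{{_ : NonZero k}} → t * k * d ≡ clauses (t * k) d k * k
multiple-nd≡mk t d k = trans (xy∙z≈xz∙y t k d) (cong (_* k) (sym (clauses-multiple t d k)))

numSatMatchings-multiple≤ : (t d k : ℕ) .{{_ : NonZero k}} .{{_ : NonZero d}} →
  numSatMatchings (t * k) d k ≤ ((t * k) C t) * (k ^ (t * d) * ((t * d) ! * (t * d * (k ∸ 1)) !))
numSatMatchings-multiple≤ t d k = begin
  numSatMatchings (t * k) d k
    ≤⟨ numSatMatchings≤C*bound (t * k) d k (multiple-nd≡mk t d k) t unique ⟩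
  ((t * k) C t) * satisfyingMatchingsBound (t * k) d k (clauses (t * k) d k) t
    ≡⟨ cong (λ m → ((t * k) C t) * satisfyingMatchingsBound (t * k) d k m t) (clauses-multiple t d k) ⟩
  ((t * k) C t) * (k ^ (t * d) * (falling (t * d) (t * d) * falling (t * k * d ∸ t * d) (t * d * (k ∸ 1))))
    ≡⟨ cong₂ (λ a b → ((t * k) C t) * (k ^ (t * d) * (a * falling b (t * d * (k ∸ 1))))) (falling-! (t * d)) tkd∸td ⟩
  ((t * k) C t) * (k ^ (t * d) * ((t * d) ! * falling (t * d * (k ∸ 1)) (t * d * (k ∸ 1))))
    ≡⟨ cong (λ a → ((t * k) C t) * (k ^ (t * d) * ((t * d) ! * a))) (falling-! (t * d * (k ∸ 1))) ⟩
  ((t * k) C t) * (k ^ (t * d) * ((t * d) ! * (t * d * (k ∸ 1)) !))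
    ∎
  where
  open ≤-Reasoning
  unique : ∀ {j} → j ≤ t * k → j * d ≡ clauses (t * k) d k → j ≡ t
  unique {j} _ jd≡m = *-cancelʳ-≡ j t d (trans jd≡m (clauses-multiple t d k))
  tkd∸td : t * k * d ∸ t * d ≡ t * d * (k ∸ 1)
  tkd∸td = trans (cong (_∸ t * d) (xy∙z≈xz∙y t k d)) (m*k∸m≡m*[k∸1] (t * d) k)

factorial-split : (m k : ℕ) → .{{NonZero k}} → (m * k) ! ≡ ((m * k) C m) * (m ! * (m * (k ∸ 1)) !)
factorial-split m k = begin-equality
  (m * k) !                                   ≡⟨ C*!*!≡! (m≤m*n m k) ⟨
  ((m * k) C m) * (m ! * (m * k ∸ m) !)       ≡⟨ cong (λ l → ((m * k) C m) * (m ! * l !)) (m*k∸m≡m*[k∸1] m k) ⟩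
  ((m * k) C m) * (m ! * (m * (k ∸ 1)) !)     ∎
  where open ≤-Reasoning

numMatchings>0 : (n d k : ℕ) .{{_ : NonZero k}} → k ∣ d * n → 0 < numMatchings n d k
numMatchings>0 n d k k∣dn = <-≤-trans (1≤n! (clauses n d k * k)) (numMatchings≥ n d k (k∣dn⇒nd≡mk n d k k∣dn))

firstMoment : (t d k c : ℕ) .{{_ : NonZero k}} .{{_ : NonZero d}} →
  c * ((t * k) C t) * k ^ (t * d) < (t * d * k) C (t * d) →
  c * numSatMatchings (t * k) d k < numMatchings (t * k) d k
firstMoment t d k c ratio< = begin-strict
  c * numSatMatchings (t * k) d k                ≤⟨ *-monoʳ-≤ c (numSatMatchings-multiple≤ t d k) ⟩
  c * (((t * k) C t) * (k ^ (t * d) * F))        ≡⟨ regroup c ((t * k) C t) (k ^ (t * d)) F ⟩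
  c * ((t * k) C t) * k ^ (t * d) * F            <⟨ *-monoˡ-< F {{F≢0}} ratio< ⟩
  ((t * d * k) C (t * d)) * F                    ≡⟨ factorial-split (t * d) k ⟨
  (t * d * k) !                                  ≡⟨ cong (λ m → (m * k) !) (clauses-multiple t d k) ⟨
  (clauses (t * k) d k * k) !                    ≤⟨ numMatchings≥ (t * k) d k (multiple-nd≡mk t d k) ⟩
  numMatchings (t * k) d k                       ∎
  where
  open ≤-Reasoning
  F : ℕ
  F = (t * d) ! * (t * d * (k ∸ 1)) !
  F≢0 : NonZero F
  F≢0 = (t * d) !* (t * d * (k ∸ 1)) !≢0
  regroup : (a b c f : ℕ) → a * (b * (c * f)) ≡ a * b * c * f
  regroup = solve-∀

lemma1 : (d k : ℕ) .{{_ : NonZero k}} → 1 ≤ d → 2 ≤ k → AboveThreshold d k →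
    (r : ℕ) → ∃[ N ] ((n : ℕ) → N ≤ n → k ∣ d * n →
      suc r * numSatMatchings n d k < numMatchings n d k)
lemma1 d@(suc d₁) k@(suc x@(suc _)) (s≤s z≤n) (s≤s (s≤s z≤n)) above r
  with exponential-dominates (suc r) (d * k) (k * x ^ (d₁ * x)) (k ^ (d₁ * x))
         (*-mono-≤ {1} {k} (s≤s z≤n) (m^n>0 x (d₁ * x))) above
... | t₀ , dominates = t₀ * k , first-moment
  where
  first-moment : (n : ℕ) → t₀ * k ≤ n → k ∣ d * n → suc r * numSatMatchings n d k < numMatchings n d k
  first-moment n t₀k≤n k∣dn with k ∣? n
  ... | no k∤n = begin-strict
    suc r * numSatMatchings n d k   ≡⟨ cong (suc r *_) (numSatMatchings≡0 n d k k∣dn k∤n) ⟩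
    suc r * 0                       ≡⟨ *-zeroʳ (suc r) ⟩
    0                               <⟨ numMatchings>0 n d k k∣dn ⟩
    numMatchings n d k              ∎
    where open ≤-Reasoning
  ... | yes (divides t refl) =
    firstMoment t d k (suc r) (binomialRatio< x d₁ t (suc r) (dominates t (*-cancelʳ-≤ t₀ t k t₀k≤n)))
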